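{- Let $1/n\ll\mu\ll1$, and let $T$ be an $n$-vertex tree with bipartition classes $V_1,V_2$ such that $|V_1|\ge1.1|V_2|$. Then there are subtrees $T_1,T_2$ of $T$ that form a decomposition of $T$ and share a unique common vertex $v$, such that $10\mu n\le |V(T_1)\cap V_1|-|V(T_1)\cap V_2|\le 25\mu n$.
   Context: Hierarchy notation "$1/n\ll\mu\ll1$": $\mu$ is sufficiently small and $n$ sufficiently large in terms of $\mu$. Subgraphs $T_1,T_2$ of a tree $T$ form a decomposition of $T$ if they are edge-disjoint subforests with $E(T)=E(T_1)\cup E(T_2)$. -}

module Defs where

open import Data.Nat using (ℕ; zero; suc; _≤_)
open import Data.Bool using (Bool; true; false; _∧_; not; if_then_else_)
open import Data.Fin using (Fin)
open import Data.List using (List; []; _∷_; length; map; _∷ʳ_; allFin)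
open import Data.Nat.ListAction using (sum)
open import Data.List.Relation.Unary.Linked using (Linked)
open import Data.List.Relation.Unary.Unique.Propositional using (Unique)
open import Data.Product using (Σ; ∃; _×_)
open import Data.Empty using (⊥)
open import Relation.Binary.PropositionalEquality using (_≡_; _≢_)
open import Relation.Nullary using (¬_)

record Graph (n : ℕ) : Set where
  field
    adj    : Fin n → Fin n → Bool
    sym    : ∀ x y → adj x y ≡ true → adj y x ≡ true
    irrefl : ∀ x → adj x x ≡ false

data Walk {n : ℕ} (E : Fin n → Fin n → Bool) : Fin n → Fin n → Set where
  here : ∀ {x} → Walk E x x
  step : ∀ {x y z} → E x y ≡ true → Walk E y z → Walk E x z

Connected : {n : ℕ} → (Fin n → Bool) → (Fin n → Fin n → Bool) → Set
Connected V E = ∀ x y → V x ≡ true → V y ≡ true → Walk E x y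

IsCycle : {n : ℕ} → (Fin n → Fin n → Bool) → List (Fin n) → Set
IsCycle E [] = ⊥
IsCycle E (x ∷ ys) =
  Unique (x ∷ ys) × (3 ≤ length (x ∷ ys))
  × Linked (λ a b → E a b ≡ true) ((x ∷ ys) ∷ʳ x)

Acyclic : {n : ℕ} → (Fin n → Fin n → Bool) → Set
Acyclic E = ∀ c → ¬ IsCycle E c

IsTree : {n : ℕ} → (Fin n → Bool) → (Fin n → Fin n → Bool) → Set
IsTree V E = (∃ λ x → V x ≡ true) × Connected V E × Acyclic E

IsSubgraph : {n : ℕ} → Graph n → (Fin n → Bool) → (Fin n → Fin n → Bool) → Set
IsSubgraph G V E =
  (∀ x y → E x y ≡ true → Graph.adj G x y ≡ true)
  × (∀ x y → E x y ≡ true → E y x ≡ true)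
  × (∀ x y → E x y ≡ true → V x ≡ true)

IsSubtree : {n : ℕ} → Graph n → (Fin n → Bool) → (Fin n → Fin n → Bool) → Set
IsSubtree G V E = IsSubgraph G V E × IsTree V E

IsTreeGraph : {n : ℕ} → Graph n → Set
IsTreeGraph G = IsTree (λ _ → true) (Graph.adj G)

-- c is a proper 2-colouring; the bipartition classes are V₁ = c⁻¹(true), V₂ = c⁻¹(false).
IsBipartition : {n : ℕ} → Graph n → (Fin n → Bool) → Set
IsBipartition G c = ∀ x y → Graph.adj G x y ≡ true → c x ≢ c y

count : {n : ℕ} → (Fin n → Bool) → ℕ
count {n} p = sum (map (λ i → if p i then 1 else 0) (allFin n))

EdgePartition : {n : ℕ} → Graph n → (Fin n → Fin n → Bool) → (Fin n → Fin n → Bool) → Set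
EdgePartition G E₁ E₂ =
  (∀ x y → Graph.adj G x y ≡ true → (E₁ x y ≡ true) Data.Sum.⊎ (E₂ x y ≡ true))
  × (∀ x y → ¬ (E₁ x y ≡ true × E₂ x y ≡ true))
  where import Data.Sum

{-# OPTIONS --safe #-}
-- Write μ = p/q, weigh each vertex +q or −q according to its colour, and put θ = 10pn.
-- Once n ≥ q every single vertex weighs less than θ, and 10|V₁| ≥ 11|V₂| gives
-- 21(|V₁| − |V₂|) ≥ n, so for μ ≤ 1/210 the whole tree weighs at least θ.
-- Root the tree and let v be a deepest vertex whose subtree weighs at least θ. The
-- subtrees hanging from the children of v all weigh less than θ, so adding them to {v}
-- one at a time raises the weight by less than θ per step, from below θ to at least θ;
-- some intermediate union weighs in [θ, 2θ). It is T₁, and the rest of the tree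
-- together with v is T₂. Dividing by q: 10μn ≤ |V(T₁) ∩ V₁| − |V(T₁) ∩ V₂| < 20μn.
module Submission where

open import Defs

module Walks where

  open import Data.Bool using (Bool; true; _∧_)
  open import Data.Bool.Properties using (∧-conicalˡ; ∧-conicalʳ)
  open import Data.Fin using (Fin)
  open import Data.List using ([]; _∷_)
  import Data.List.Relation.Unary.Linked as Linked
  open import Data.Nat using (ℕ)
  open import Data.Product using (_,_)
  open import Relation.Binary.PropositionalEquality using (_≡_; cong₂; trans)

  private variable
    n : ℕ

  SymmetricEdges : (Fin n → Fin n → Bool) → Set
  SymmetricEdges E = ∀ x y → E x y ≡ true → E y x ≡ true

  restrict-symmetric : ∀ {E Q : Fin n → Fin n → Bool} → SymmetricEdges E → (∀ x y → Q x y ≡ Q y x) →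
                       SymmetricEdges (λ x y → E x y ∧ Q x y)
  restrict-symmetric E-sym Q-sym x y e =
    cong₂ _∧_ (E-sym x y (∧-conicalˡ _ _ e)) (trans (Q-sym y x) (∧-conicalʳ _ _ e))

  _++ʷ_ : ∀ {E : Fin n → Fin n → Bool} {x y z} → Walk E x y → Walk E y z → Walk E x z
  here     ++ʷ w′ = w′
  step e w ++ʷ w′ = step e (w ++ʷ w′)

  reverseʷ : ∀ {E : Fin n → Fin n → Bool} → SymmetricEdges E → ∀ {x y} → Walk E x y → Walk E y x
  reverseʷ sym here       = here
  reverseʷ sym (step e w) = reverseʷ sym w ++ʷ step (sym _ _ e) here

  connected-via : ∀ {V : Fin n → Bool} {E} t → SymmetricEdges E →
                  (∀ x → V x ≡ true → Walk E x t) → Connected V E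
  connected-via t sym to-t x y Vx Vy = to-t x Vx ++ʷ reverseʷ sym (to-t y Vy)

  acyclic-⊆ : ∀ {E E′ : Fin n → Fin n → Bool} → (∀ x y → E′ x y ≡ true → E x y ≡ true) →
              Acyclic E → Acyclic E′
  acyclic-⊆ E′⊆E acyclic []       ()
  acyclic-⊆ E′⊆E acyclic (x ∷ ys) (unique , long , linked) =
    acyclic (x ∷ ys) (unique , long , Linked.map (E′⊆E _ _) linked)

module Weights where

  open import Data.Bool using (Bool; true; false; not; _∧_; _∨_; if_then_else_)
  open import Data.Empty using (⊥-elim)
  open import Data.Fin using (Fin; zero; suc; punchIn)
  open import Data.Fin.Properties using (punchInᵢ≢i)
  open import Data.Integer as ℤ using (ℤ; +_; 0ℤ)
  import Data.Integer.Properties as ℤ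
  open import Algebra.Properties.Semiring.Sum ℤ.+-*-semiring
    using (sum; sum-cong-≗; ∑-distrib-+; sum-remove; sum-replicate-zero; *-distribˡ-sum)
  open import Data.Integer.Tactic.RingSolver using (solve-∀)
  open import Data.List.Properties using (map-tabulate)
  open import Data.Nat as ℕ using (ℕ)
  import Data.Nat.ListAction as ListAction
  import Data.Nat.Properties as ℕ
  open import Data.Product using (_×_; _,_)
  open import Function using (_∘_; _⇔_)
  open import Relation.Binary.PropositionalEquality
  open import Relation.Nullary using (¬_; Dec; yes; does)
  open import Relation.Nullary.Decidable using (does-⇔; dec-true; dec-false)
  open import Relation.Unary using (Decidable)
  open import Relation.Unary.Properties using (_∪?_)

  private variable
    n : ℕ

  weight : (Fin n → ℤ) → (Fin n → Bool) → ℤ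
  weight w p = sum (λ i → if p i then w i else 0ℤ)

  weight-cong : ∀ (w : Fin n → ℤ) {p q} → (∀ i → p i ≡ q i) → weight w p ≡ weight w q
  weight-cong w p≗q = sum-cong-≗ (λ i → cong (λ b → if b then w i else 0ℤ) (p≗q i))

  weight-∨ : ∀ (w : Fin n → ℤ) p q → (∀ i → ¬ (p i ≡ true × q i ≡ true)) →
             weight w (λ i → p i ∨ q i) ≡ weight w p ℤ.+ weight w q
  weight-∨ w p q disjoint =
    trans (sum-cong-≗ pointwise) (∑-distrib-+ (λ i → if p i then w i else 0ℤ) (λ i → if q i then w i else 0ℤ))
    where
    pointwise : ∀ i → (if p i ∨ q i then w i else 0ℤ)
                    ≡ (if p i then w i else 0ℤ) ℤ.+ (if q i then w i else 0ℤ)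
    pointwise i with p i | q i | disjoint i
    ... | true  | true  | p∧q = ⊥-elim (p∧q (refl , refl))
    ... | true  | false | _   = sym (ℤ.+-identityʳ (w i))
    ... | false | _     | _   = sym (ℤ.+-identityˡ _)

  weight-empty : ∀ (w : Fin n → ℤ) {p} → (∀ i → p i ≡ false) → weight w p ≡ 0ℤ
  weight-empty {n} w p≗∅ = trans (weight-cong w p≗∅) (sum-replicate-zero n)

  weight-singleton : ∀ (w : Fin n → ℤ) {p} v → p v ≡ true → (∀ i → p i ≡ true → i ≡ v) → weight w p ≡ w v
  weight-singleton {ℕ.suc n} w {p} v pv only-v = begin
    weight w p
      ≡⟨ sum-remove {i = v} (λ i → if p i then w i else 0ℤ) ⟩
    (if p v then w v else 0ℤ) ℤ.+ weight (w ∘ punchIn v) (p ∘ punchIn v)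
      ≡⟨ cong₂ ℤ._+_ (cong (λ b → if b then w v else 0ℤ) pv) (weight-empty (w ∘ punchIn v) ∉p) ⟩
    w v ℤ.+ 0ℤ
      ≡⟨ ℤ.+-identityʳ (w v) ⟩
    w v ∎
    where
    open ≡-Reasoning
    ∉p : ∀ j → p (punchIn v j) ≡ false
    ∉p j with p (punchIn v j) in eq
    ... | true  = ⊥-elim (punchInᵢ≢i v j (only-v _ eq))
    ... | false = refl

  weight-scale : ∀ k (w : Fin n → ℤ) p → weight (λ i → k ℤ.* w i) p ≡ k ℤ.* weight w p
  weight-scale k w p = sym (trans (*-distribˡ-sum k (λ i → if p i then w i else 0ℤ)) (sum-cong-≗ pointwise))
    where
    pointwise : ∀ i → k ℤ.* (if p i then w i else 0ℤ) ≡ (if p i then k ℤ.* w i else 0ℤ)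
    pointwise i with p i
    ... | true  = refl
    ... | false = ℤ.*-zeroʳ k

  does-true⁻ : ∀ {A : Set} (a? : Dec A) → does a? ≡ true → A
  does-true⁻ (yes a) _ = a

  module _ (w : Fin n → ℤ) {P Q : Fin n → Set} (P? : Decidable P) (Q? : Decidable Q) where

    weight-⇔ : (∀ x → P x ⇔ Q x) → weight w (does ∘ P?) ≡ weight w (does ∘ Q?)
    weight-⇔ P⇔Q = weight-cong w (λ x → does-⇔ (P⇔Q x) (P? x) (Q? x))

    weight-⊎ : (∀ x → ¬ (P x × Q x)) → weight w (does ∘ (P? ∪? Q?)) ≡ weight w (does ∘ P?) ℤ.+ weight w (does ∘ Q?)
    weight-⊎ disjoint = weight-∨ w (does ∘ P?) (does ∘ Q?)
      (λ x (p , q) → disjoint x (does-true⁻ (P? x) p , does-true⁻ (Q? x) q))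

  weight-∅ : ∀ (w : Fin n → ℤ) {P : Fin n → Set} (P? : Decidable P) → (∀ x → ¬ P x) → weight w (does ∘ P?) ≡ 0ℤ
  weight-∅ w P? ∅ = weight-empty w (λ x → dec-false (P? x) (∅ x))

  weight-single : ∀ (w : Fin n → ℤ) {P : Fin n → Set} (P? : Decidable P) v → P v →
                  (∀ x → P x → x ≡ v) → weight w (does ∘ P?) ≡ w v
  weight-single w P? v Pv only-v =
    weight-singleton w v (dec-true (P? v) Pv) (λ x e → only-v x (does-true⁻ (P? x) e))

  sign : Bool → ℤ
  sign true  = + 1
  sign false = ℤ.-1ℤ

  imbalance : (Fin n → Bool) → (Fin n → Bool) → ℤ
  imbalance c = weight (sign ∘ c)

  indicator : Bool → ℕ
  indicator b = if b then 1 else 0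

  count-suc : ∀ (p : Fin (ℕ.suc n) → Bool) → count p ≡ indicator (p zero) ℕ.+ count (p ∘ suc)
  count-suc p = cong (indicator (p zero) ℕ.+_) (cong ListAction.sum
    (trans (map-tabulate suc (indicator ∘ p)) (sym (map-tabulate (λ i → i) (indicator ∘ p ∘ suc)))))

  signed-indicator : ∀ b c → + indicator (b ∧ c) ℤ.- + indicator (b ∧ not c) ≡ (if b then sign c else 0ℤ)
  signed-indicator false c     = refl
  signed-indicator true  true  = refl
  signed-indicator true  false = refl

  pos-sum-difference : ∀ a b c d → + (a ℕ.+ b) ℤ.- + (c ℕ.+ d) ≡ (+ a ℤ.- + c) ℤ.+ (+ b ℤ.- + d)
  pos-sum-difference a b c d =
    trans (cong₂ ℤ._-_ (ℤ.pos-+ a b) (ℤ.pos-+ c d)) (regroup (+ a) (+ b) (+ c) (+ d))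
    where
    regroup : ∀ (a b c d : ℤ) → (a ℤ.+ b) ℤ.- (c ℤ.+ d) ≡ (a ℤ.- c) ℤ.+ (b ℤ.- d)
    regroup = solve-∀

  surplus : (c p : Fin n → Bool) → ℤ
  surplus c p = + count (λ x → p x ∧ c x) ℤ.- + count (λ x → p x ∧ not (c x))

  surplus≡imbalance : ∀ (c p : Fin n → Bool) → surplus c p ≡ imbalance c p
  surplus≡imbalance {ℕ.zero}  c p = refl
  surplus≡imbalance {ℕ.suc n} c p = begin
    + count p∧c ℤ.- + count p∧¬c
      ≡⟨ cong₂ (λ a b → + a ℤ.- + b) (count-suc p∧c) (count-suc p∧¬c) ⟩
    + (indicator (p∧c zero) ℕ.+ count (p∧c ∘ suc)) ℤ.- + (indicator (p∧¬c zero) ℕ.+ count (p∧¬c ∘ suc))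
      ≡⟨ pos-sum-difference (indicator (p∧c zero)) (count (p∧c ∘ suc))
                            (indicator (p∧¬c zero)) (count (p∧¬c ∘ suc)) ⟩
    (+ indicator (p∧c zero) ℤ.- + indicator (p∧¬c zero)) ℤ.+ (+ count (p∧c ∘ suc) ℤ.- + count (p∧¬c ∘ suc))
      ≡⟨ cong₂ ℤ._+_ (signed-indicator (p zero) (c zero)) (surplus≡imbalance (c ∘ suc) (p ∘ suc)) ⟩
    imbalance c p ∎
    where
    open ≡-Reasoning
    p∧c p∧¬c : Fin (ℕ.suc n) → Bool
    p∧c x = p x ∧ c x
    p∧¬c x = p x ∧ not (c x)

  count-complement : ∀ (c : Fin n → Bool) → count c ℕ.+ count (not ∘ c) ≡ n
  count-complement {ℕ.zero}  c = refl
  count-complement {ℕ.suc n} c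
    rewrite count-suc c | count-suc (not ∘ c) with c zero
  ... | true  = cong ℕ.suc (count-complement (c ∘ suc))
  ... | false = trans (ℕ.+-suc _ _) (cong ℕ.suc (count-complement (c ∘ suc)))

module Extremal where

  open import Data.Fin using (Fin; zero; suc)
  open import Data.Fin.Properties using (any?)
  open import Data.Integer as ℤ using (ℤ)
  import Data.Integer.Properties as ℤ
  open import Data.Nat using (ℕ; zero; suc; _≤_; _<_; _≤?_; z≤n)
  open import Data.Nat.Properties using (≤-refl; ≤-trans; <⇒≤; ≰⇒>; ≤-pred; m≤n⇒m<n∨m≡n)
  open import Data.Product using (∃; _×_; _,_)
  open import Data.Sum using (_⊎_; inj₁; inj₂)
  open import Function using (_∘_)
  open import Relation.Binary.PropositionalEquality using (_≡_; refl)
  open import Relation.Nullary using (¬_; yes; no; contradiction)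
  open import Relation.Unary using (Decidable)

  Minimal : (ℕ → Set) → ℕ → Set
  Minimal P m = P m × (∀ j → j < m → ¬ P j)

  minimal-or-none : (P : ℕ → Set) → Decidable P → ∀ k → ∃ (Minimal P) ⊎ (∀ j → j ≤ k → ¬ P j)
  minimal-or-none P P? zero with P? zero
  ... | yes P0 = inj₁ (zero , P0 , λ _ ())
  ... | no ¬P0 = inj₂ λ { zero z≤n → ¬P0 }
  minimal-or-none P P? (suc k) with minimal-or-none P P? k
  ... | inj₁ found = inj₁ found
  ... | inj₂ none with P? (suc k)
  ...   | yes Pk = inj₁ (suc k , Pk , λ j j<1+k → none j (≤-pred j<1+k))
  ...   | no ¬Pk = inj₂ λ j j≤1+k → case-≤ j j≤1+k ¬Pk
    where
    case-≤ : ∀ j → j ≤ suc k → ¬ P (suc k) → ¬ P j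
    case-≤ j j≤1+k ¬Pk with m≤n⇒m<n∨m≡n j≤1+k
    ... | inj₁ j<1+k = none j (≤-pred j<1+k)
    ... | inj₂ refl  = ¬Pk

  minimal-witness : (P : ℕ → Set) → Decidable P → ∀ k → P k → ∃ (Minimal P)
  minimal-witness P P? k Pk with minimal-or-none P P? k
  ... | inj₁ found = found
  ... | inj₂ none  = contradiction Pk (none k ≤-refl)

  maximiser : ∀ {n} (P : Fin n → Set) → Decidable P → (f : Fin n → ℕ) → ∀ x → P x →
              ∃ λ v → P v × (∀ u → P u → f u ≤ f v)
  maximiser {suc n} P P? f x Px with any? (P? ∘ suc)
  ... | no ¬P∘suc = zero , P-zero x Px , λ { zero _ → ≤-refl ; (suc u) Pu → contradiction (u , Pu) ¬P∘suc }
    where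
    P-zero : ∀ x → P x → P zero
    P-zero zero    Pz = Pz
    P-zero (suc x) Px = contradiction (x , Px) ¬P∘suc
  ... | yes (y , Py) with maximiser (P ∘ suc) (P? ∘ suc) (f ∘ suc) y Py | P? zero
  ...   | v , Pv , max | no ¬Pz = suc v , Pv , λ { zero Pz → contradiction Pz ¬Pz ; (suc u) Pu → max u Pu }
  ...   | v , Pv , max | yes Pz with f zero ≤? f (suc v)
  ...     | yes fz≤fv = suc v , Pv , λ { zero _ → fz≤fv ; (suc u) Pu → max u Pu }
  ...     | no  fz≰fv = zero , Pz , λ { zero _ → ≤-refl ; (suc u) Pu → ≤-trans (max u Pu) (<⇒≤ (≰⇒> fz≰fv)) }

  discrete-ivt : ∀ (F : ℕ → ℤ) θ δ → (∀ k → F (suc k) ℤ.< F k ℤ.+ δ) → F zero ℤ.< θ →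
                 ∀ N → θ ℤ.≤ F N → ∃ λ k → θ ℤ.≤ F k × F k ℤ.< θ ℤ.+ δ
  discrete-ivt F θ δ jump F0<θ zero θ≤F0 = contradiction θ≤F0 (ℤ.<⇒≱ F0<θ)
  discrete-ivt F θ δ jump F0<θ (suc N) θ≤F with θ ℤ.≤? F N
  ... | yes θ≤FN = discrete-ivt F θ δ jump F0<θ N θ≤FN
  ... | no  θ≰FN = suc N , θ≤F , ℤ.<-trans (jump N) (ℤ.+-monoˡ-< δ (ℤ.≰⇒> θ≰FN))

module RootedTrees where

  open import Data.Bool using (Bool; true; false; not; _∧_; _∨_)
  import Data.Bool.Properties as Bool
  open import Data.Empty using (⊥; ⊥-elim)
  open import Data.Fin using (Fin; _≟_)
  open import Data.Fin.Properties using (any?)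
  open import Data.List using (List; []; _∷_; _∷ʳ_; length)
  open import Data.List.Properties using (length-++)
  open import Data.List.Relation.Unary.All as All using (All; []; _∷_)
  open import Data.List.Relation.Unary.All.Properties using (∷ʳ⁺)
  open import Data.List.Relation.Unary.AllPairs using ([]; _∷_)
  open import Data.List.Relation.Unary.Linked using (Linked; []; [-]; _∷_)
  open import Data.List.Relation.Unary.Unique.Propositional using (Unique)
  open import Data.Nat using (ℕ; zero; suc; _+_; _∸_; _≤_; _<_; z≤n; s≤s; z<s)
  open import Data.Nat.Properties hiding (_≟_)
  open import Data.Product using (Σ; ∃; _×_; _,_; proj₁; proj₂)
  open import Data.Sum using (_⊎_; inj₁; inj₂)
  open import Relation.Binary.PropositionalEquality
  open import Relation.Binary using (tri<; tri≈; tri>)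
  open import Function using (_∘_)
  open import Relation.Nullary using (¬_; yes; no; does; contradiction)
  open import Relation.Nullary.Decidable using (_×-dec_; _⊎-dec_; dec-true; dec-false)
  open import Relation.Unary using (Decidable)
  open Extremal using (Minimal; minimal-witness)
  open Walks using (restrict-symmetric; connected-via; acyclic-⊆)

  not-both : ∀ {b} → b ≡ true → not b ≡ true → ⊥
  not-both refl ()

  linked-∷ʳ : ∀ {A : Set} {R : A → A → Set} xs {x y} → Linked R (xs ∷ʳ x) → R x y → Linked R ((xs ∷ʳ x) ∷ʳ y)
  linked-∷ʳ []           [-]        Rxy = Rxy ∷ [-]
  linked-∷ʳ (_ ∷ [])     (R ∷ [-])  Rxy = R ∷ Rxy ∷ [-]
  linked-∷ʳ (_ ∷ _ ∷ xs) (R ∷ Rxs)  Rxy = R ∷ linked-∷ʳ (_ ∷ xs) Rxs Rxy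

  unique-∷ʳ : ∀ {A : Set} xs {x : A} → Unique xs → All (_≢ x) xs → Unique (xs ∷ʳ x)
  unique-∷ʳ []       _          _            = [] ∷ []
  unique-∷ʳ (_ ∷ xs) (u ∷ uxs) (y≢x ∷ xs≢x) = ∷ʳ⁺ u y≢x ∷ unique-∷ʳ xs uxs xs≢x

  length-∷ʳ : ∀ {A : Set} (xs : List A) x → length (xs ∷ʳ x) ≡ suc (length xs)
  length-∷ʳ xs x = trans (length-++ xs) (+-comm (length xs) 1)

  MeetExactlyAt : ∀ {n} → (Fin n → Bool) → (Fin n → Bool) → Fin n → Set
  MeetExactlyAt V₁ V₂ v = V₁ v ≡ true × V₂ v ≡ true × (∀ w → V₁ w ≡ true → V₂ w ≡ true → w ≡ v)

  SubtreeDecomposition : ∀ {n} → Graph n → (V₁ : Fin n → Bool) (E₁ : Fin n → Fin n → Bool)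
                         (V₂ : Fin n → Bool) (E₂ : Fin n → Fin n → Bool) → Set
  SubtreeDecomposition T V₁ E₁ V₂ E₂ =
    IsSubtree T V₁ E₁ × IsSubtree T V₂ E₂ × EdgePartition T E₁ E₂ × ∃ (MeetExactlyAt V₁ V₂)

  module Rooted {n} (T : Graph n) (r : Fin n) (to-root : ∀ x → Walk (Graph.adj T) x r) where

    open Graph T using (adj)

    _~_ : Fin n → Fin n → Set
    x ~ y = adj x y ≡ true

    ~-sym : ∀ {x y} → x ~ y → y ~ x
    ~-sym = Graph.sym T _ _

    ~-irrefl : ∀ {x y} → x ~ y → x ≢ y
    ~-irrefl {x} x~x refl with trans (sym x~x) (Graph.irrefl T x)
    ... | ()

    WithinDistance : ℕ → Fin n → Set
    WithinDistance zero    x = x ≡ r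
    WithinDistance (suc k) x = WithinDistance k x ⊎ ∃ λ y → x ~ y × WithinDistance k y

    within? : ∀ k → Decidable (WithinDistance k)
    within? zero    x = x ≟ r
    within? (suc k) x = within? k x ⊎-dec any? (λ y → (adj x y Bool.≟ true) ×-dec within? k y)

    walk-within : ∀ {x} → Walk adj x r → ∃ λ k → WithinDistance k x
    walk-within here = 0 , refl
    walk-within (step x~y w) with walk-within w
    ... | k , within = suc k , inj₂ (_ , x~y , within)

    opaque
      distance : ∀ x → ∃ (Minimal λ k → WithinDistance k x)
      distance x = minimal-witness _ (λ k → within? k x) _ (proj₂ (walk-within (to-root x)))

      depth : Fin n → ℕ
      depth x = proj₁ (distance x)

      within-depth : ∀ x → WithinDistance (depth x) x
      within-depth x = proj₁ (proj₂ (distance x))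

      depth-minimal : ∀ x k → WithinDistance k x → depth x ≤ k
      depth-minimal x k within = ≮⇒≥ λ k<d → proj₂ (proj₂ (distance x)) k k<d within

    depth-root : depth r ≡ 0
    depth-root = n≤0⇒n≡0 (depth-minimal r 0 refl)

    depth≡0⇒root : ∀ {x} → depth x ≡ 0 → x ≡ r
    depth≡0⇒root {x} d≡0 = subst (λ k → WithinDistance k x) d≡0 (within-depth x)

    depth>0⇒≢root : ∀ {x} → 0 < depth x → x ≢ r
    depth>0⇒≢root 0<d refl = <-irrefl (sym depth-root) 0<d

    depth-adjacent : ∀ {x y} → x ~ y → depth x ≤ suc (depth y)
    depth-adjacent {x} {y} x~y = depth-minimal x (suc (depth y)) (inj₂ (y , x~y , within-depth y))

    toward-root : ∀ x → x ≢ r → ∃ λ y → x ~ y × depth x ≡ suc (depth y)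
    toward-root x x≢r = go (depth x) refl
      where
      go : ∀ k → depth x ≡ k → ∃ λ y → x ~ y × depth x ≡ suc (depth y)
      go zero    d≡0   = contradiction (depth≡0⇒root d≡0) x≢r
      go (suc k) d≡1+k with subst (λ j → WithinDistance j x) d≡1+k (within-depth x)
      ... | inj₁ within-k = contradiction (subst (_≤ k) d≡1+k (depth-minimal x k within-k)) 1+n≰n
      ... | inj₂ (y , x~y , within-y) =
        y , x~y , trans d≡1+k (cong suc (≤-antisym k≤dy (depth-minimal y k within-y)))
        where
        k≤dy : k ≤ depth y
        k≤dy = ≤-pred (subst (_≤ suc (depth y)) d≡1+k (depth-adjacent x~y))

    -- The root is its own parent; the lemmas about parent x all assume x ≢ r.
    opaque
      parent : Fin n → Fin n
      parent x with x ≟ r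
      ... | yes _   = r
      ... | no x≢r = proj₁ (toward-root x x≢r)

      parent-adjacent : ∀ {x} → x ≢ r → x ~ parent x
      parent-adjacent {x} x≢r with x ≟ r
      ... | yes x≡r  = contradiction x≡r x≢r
      ... | no  x≢r′ = proj₁ (proj₂ (toward-root x x≢r′))

      depth-parent : ∀ {x} → x ≢ r → depth x ≡ suc (depth (parent x))
      depth-parent {x} x≢r with x ≟ r
      ... | yes x≡r  = contradiction x≡r x≢r
      ... | no  x≢r′ = proj₂ (proj₂ (toward-root x x≢r′))

    depth≡suc⇒parent : ∀ {x d} → depth x ≡ suc d → x ≢ r × depth (parent x) ≡ d
    depth≡suc⇒parent {x} d≡1+d = x≢r , suc-injective (trans (sym (depth-parent x≢r)) d≡1+d)
      where
      x≢r : x ≢ r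
      x≢r = depth>0⇒≢root (subst (0 <_) (sym d≡1+d) z<s)

    ancestor : ℕ → Fin n → Fin n
    ancestor zero    x = x
    ancestor (suc m) x = ancestor m (parent x)

    depth-ancestor : ∀ m x → m ≤ depth x → depth (ancestor m x) + m ≡ depth x
    depth-ancestor zero    x _   = +-identityʳ _
    depth-ancestor (suc m) x m<d = begin
      depth (ancestor m (parent x)) + suc m ≡⟨ +-suc _ m ⟩
      suc (depth (ancestor m (parent x)) + m) ≡⟨ cong suc (depth-ancestor m (parent x) m≤dp) ⟩
      suc (depth (parent x))                  ≡⟨ depth-parent x≢r ⟨
      depth x                                 ∎
      where
      open ≡-Reasoning
      x≢r : x ≢ r
      x≢r = depth>0⇒≢root (≤-trans (s≤s z≤n) m<d)
      m≤dp : m ≤ depth (parent x)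
      m≤dp = ≤-pred (subst (suc m ≤_) (depth-parent x≢r) m<d)

    parent-ancestor : ∀ m x → parent (ancestor m x) ≡ ancestor m (parent x)
    parent-ancestor zero    x = refl
    parent-ancestor (suc m) x = parent-ancestor m (parent x)

    ancestorAt : ℕ → Fin n → Fin n
    ancestorAt k x = ancestor (depth x ∸ k) x

    depth-ancestorAt : ∀ {k x} → k ≤ depth x → depth (ancestorAt k x) ≡ k
    depth-ancestorAt {k} {x} k≤d = +-cancelʳ-≡ (depth x ∸ k) _ _
      (trans (depth-ancestor (depth x ∸ k) x (m∸n≤m _ k)) (sym (m+[n∸m]≡n k≤d)))

    ancestorAt-depth : ∀ x → ancestorAt (depth x) x ≡ x
    ancestorAt-depth x rewrite n∸n≡0 (depth x) = refl

    ancestorAt-zero : ∀ x → ancestorAt 0 x ≡ r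
    ancestorAt-zero x = depth≡0⇒root (depth-ancestorAt z≤n)

    parent-ancestorAt : ∀ {k x} → k < depth x → parent (ancestorAt (suc k) x) ≡ ancestorAt k x
    parent-ancestorAt {k} {x} k<d rewrite +-∸-assoc 1 k<d = parent-ancestor (depth x ∸ suc k) x

    ancestorAt-parent : ∀ {k x} → x ≢ r → k ≤ depth (parent x) → ancestorAt k (parent x) ≡ ancestorAt k x
    ancestorAt-parent {k} {x} x≢r k≤dp rewrite depth-parent x≢r | +-∸-assoc 1 k≤dp = refl

    walk-up : ∀ (E : Fin n → Fin n → Bool) (P : Fin n → Set) t →
              (∀ x → P x → x ≢ t → x ≢ r × E x (parent x) ≡ true × P (parent x)) →
              ∀ x → P x → Walk E x t
    walk-up E P t climb x Px = go (depth x) x ≤-refl Px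
      where
      go : ∀ m x → depth x ≤ m → P x → Walk E x t
      go m x d≤m Px with x ≟ t
      ... | yes refl = here
      ... | no x≢t with climb x Px x≢t | m
      ...   | x≢r , _ , _      | zero   = contradiction (depth≡0⇒root (n≤0⇒n≡0 d≤m)) x≢r
      ...   | x≢r , e , Pparent | suc m′ =
              step e (go m′ (parent x) (≤-pred (subst (_≤ suc m′) (depth-parent x≢r) d≤m)) Pparent)

    ShallowPath : Fin n → Fin n → ℕ → Set
    ShallowPath x z d = Σ (List (Fin n)) λ ps →
      Unique ((x ∷ ps) ∷ʳ z) × Linked _~_ ((x ∷ ps) ∷ʳ z) × 1 ≤ length ps × All (λ u → depth u < d) ps

    shallow-path : ∀ d {x z} → depth x ≡ d → depth z ≡ d → x ≢ z → ShallowPath x z d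
    shallow-path zero    dx dz x≢z = contradiction (trans (depth≡0⇒root dx) (sym (depth≡0⇒root dz))) x≢z
    shallow-path (suc d) {x} {z} dx dz x≢z
      with depth≡suc⇒parent dx | depth≡suc⇒parent dz | parent x ≟ parent z
    ... | x≢r , dpx | z≢r , dpz | yes px≡pz =
      parent x ∷ [] , unique , linked , s≤s z≤n , ≤-reflexive (cong suc dpx) ∷ []
      where
      unique : Unique (x ∷ parent x ∷ z ∷ [])
      unique = (~-irrefl (parent-adjacent x≢r) ∷ x≢z ∷ [])
             ∷ ((λ px≡z → ~-irrefl (parent-adjacent z≢r) (trans (sym px≡z) px≡pz)) ∷ [])
             ∷ [] ∷ []
      linked : Linked _~_ (x ∷ parent x ∷ z ∷ [])
      linked = parent-adjacent x≢r ∷ subst (_~ z) (sym px≡pz) (~-sym (parent-adjacent z≢r)) ∷ [-]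
    ... | x≢r , dpx | z≢r , dpz | no px≢pz
      with shallow-path d dpx dpz px≢pz
    ...   | ps , unique , linked , _ , shallow = ps′ , unique′ , linked′ , s≤s z≤n , shallow′
      where
      ps′ : List (Fin n)
      ps′ = (parent x ∷ ps) ∷ʳ parent z
      shallow′ : All (λ u → depth u < suc d) ps′
      shallow′ = ∷ʳ⁺ (≤-reflexive (cong suc dpx) ∷ All.map m<n⇒m<1+n shallow) (≤-reflexive (cong suc dpz))
      unique′ : Unique ((x ∷ ps′) ∷ʳ z)
      unique′ = ∷ʳ⁺ (All.map (λ du<d x≡u → <-irrefl (trans (cong depth (sym x≡u)) dx) du<d) shallow′) x≢z
              ∷ unique-∷ʳ ps′ unique (All.map (λ du<d u≡z → <-irrefl (trans (cong depth u≡z) dz) du<d) shallow′)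
      linked′ : Linked _~_ ((x ∷ ps′) ∷ʳ z)
      linked′ = parent-adjacent x≢r ∷ linked-∷ʳ (parent x ∷ ps) linked (~-sym (parent-adjacent z≢r))

    module _ (acyclic : Acyclic adj) where

      adjacent-depth-≢ : ∀ {x y} → x ~ y → depth x ≢ depth y
      adjacent-depth-≢ {x} {y} x~y dx≡dy with shallow-path (depth x) refl (sym dx≡dy) (~-irrefl x~y)
      ... | ps , unique , linked , nonempty , _ =
        acyclic (x ∷ ps ∷ʳ y) (unique , long , linked-∷ʳ (x ∷ ps) linked (~-sym x~y))
        where
        long : 3 ≤ length (x ∷ ps ∷ʳ y)
        long rewrite length-∷ʳ ps y = s≤s (s≤s nonempty)

      parent-of-deeper-neighbour : ∀ {x y} → x ~ y → depth y ≡ suc (depth x) → parent y ≡ x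
      parent-of-deeper-neighbour {x} {y} x~y dy with depth≡suc⇒parent dy | parent y ≟ x
      ... | _        | yes py≡x = py≡x
      ... | y≢r , dpy | no  py≢x with shallow-path (depth x) refl dpy (py≢x ∘ sym)
      ...   | ps , unique , linked , _ , shallow =
        ⊥-elim (acyclic (x ∷ ps ∷ʳ parent y ∷ʳ y) (unique′ , long , linked′))
        where
        not-y : ∀ {u} → depth u ≤ depth x → u ≢ y
        not-y du≤dx refl = 1+n≰n (subst (_≤ depth x) dy du≤dx)
        unique′ : Unique ((x ∷ ps ∷ʳ parent y) ∷ʳ y)
        unique′ = unique-∷ʳ (x ∷ ps ∷ʳ parent y) unique
          (∷ʳ⁺ (not-y ≤-refl ∷ All.map (not-y ∘ <⇒≤) shallow) (not-y (≤-reflexive dpy)))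
        long : 3 ≤ length (x ∷ ps ∷ʳ parent y ∷ʳ y)
        long rewrite length-∷ʳ (ps ∷ʳ parent y) y | length-∷ʳ ps (parent y) = s≤s (s≤s (s≤s z≤n))
        linked′ : Linked _~_ ((x ∷ ps ∷ʳ parent y ∷ʳ y) ∷ʳ x)
        linked′ = linked-∷ʳ (x ∷ ps ∷ʳ parent y)
                    (linked-∷ʳ (x ∷ ps) linked (~-sym (parent-adjacent y≢r))) (~-sym x~y)

      edge-parent-child : ∀ {x y} → x ~ y → (x ≢ r × parent x ≡ y) ⊎ (y ≢ r × parent y ≡ x)
      edge-parent-child {x} {y} x~y with <-cmp (depth x) (depth y)
      ... | tri≈ _ dx≡dy _ = contradiction dx≡dy (adjacent-depth-≢ x~y)
      ... | tri< dx<dy _ _ =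
        inj₂ (depth>0⇒≢root (≤-<-trans z≤n dx<dy) , parent-of-deeper-neighbour x~y dy≡1+dx)
        where dy≡1+dx = ≤-antisym (depth-adjacent (~-sym x~y)) dx<dy
      ... | tri> _ _ dy<dx =
        inj₁ (depth>0⇒≢root (≤-<-trans z≤n dy<dx) , parent-of-deeper-neighbour (~-sym x~y) dx≡1+dy)
        where dx≡1+dy = ≤-antisym (depth-adjacent x~y) dy<dx

      module Cut (v : Fin n) (S : Fin n → Bool)
                 (S-up : ∀ x → S x ≡ true → x ≢ r × (parent x ≡ v ⊎ S (parent x) ≡ true))
                 (S-down : ∀ x → x ≢ r → S (parent x) ≡ true → S x ≡ true)
                 (v∉S : S v ≡ false) where

        V₁ V₂ : Fin n → Bool
        V₁ x = does (x ≟ v) ∨ S x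
        V₂ x = not (S x)

        Both : Fin n → Fin n → Bool
        Both x y = V₁ x ∧ V₁ y

        E₁ E₂ : Fin n → Fin n → Bool
        E₁ x y = adj x y ∧ Both x y
        E₂ x y = adj x y ∧ not (Both x y)

        V₁-cases : ∀ {x} → V₁ x ≡ true → x ≡ v ⊎ S x ≡ true
        V₁-cases {x} V₁x with x ≟ v
        ... | yes x≡v = inj₁ x≡v
        ... | no  _   = inj₂ V₁x

        V₁-intro : ∀ {x} → x ≡ v ⊎ S x ≡ true → V₁ x ≡ true
        V₁-intro (inj₁ refl) rewrite dec-true (v ≟ v) refl = refl
        V₁-intro {x} (inj₂ Sx) = trans (cong (does (x ≟ v) ∨_) Sx) (Bool.∨-zeroʳ _)

        V₁-outside : ∀ {x} → x ≢ v → S x ≡ false → V₁ x ≡ false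
        V₁-outside {x} x≢v Sx rewrite dec-false (x ≟ v) x≢v = Sx

        V₂-intro : ∀ {x} → ¬ S x ≡ true → V₂ x ≡ true
        V₂-intro ¬Sx = sym (Bool.¬-not (¬Sx ∘ sym))

        Both-sym : ∀ x y → Both x y ≡ Both y x
        Both-sym x y = Bool.∧-comm (V₁ x) (V₁ y)

        E₁-subgraph : IsSubgraph T V₁ E₁
        E₁-subgraph = (λ x y → Bool.∧-conicalˡ _ _)
                    , restrict-symmetric (Graph.sym T) Both-sym
                    , (λ x y e → Bool.∧-conicalˡ (V₁ x) (V₁ y) (Bool.∧-conicalʳ (adj x y) _ e))

        E₂-subgraph : IsSubgraph T V₂ E₂
        E₂-subgraph = (λ x y → Bool.∧-conicalˡ _ _)
                    , restrict-symmetric (Graph.sym T) (λ x y → cong not (Both-sym x y))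
                    , E₂-source
          where
          E₂-source : ∀ x y → E₂ x y ≡ true → V₂ x ≡ true
          E₂-source x y e = V₂-intro λ Sx →
            not-both (Both-true Sx (edge-parent-child (Bool.∧-conicalˡ _ _ e))) (Bool.∧-conicalʳ _ _ e)
            where
            Both-true : S x ≡ true → (x ≢ r × parent x ≡ y) ⊎ (y ≢ r × parent y ≡ x) → Both x y ≡ true
            Both-true Sx (inj₁ (_ , refl))   = cong₂ _∧_ (V₁-intro (inj₂ Sx)) (V₁-intro (proj₂ (S-up x Sx)))
            Both-true Sx (inj₂ (y≢r , refl)) = cong₂ _∧_ (V₁-intro (inj₂ Sx)) (V₁-intro (inj₂ (S-down y y≢r Sx)))

        to-v : ∀ x → V₁ x ≡ true → Walk E₁ x v
        to-v = walk-up E₁ (λ x → V₁ x ≡ true) v climb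
          where
          climb : ∀ x → V₁ x ≡ true → x ≢ v → x ≢ r × E₁ x (parent x) ≡ true × V₁ (parent x) ≡ true
          climb x V₁x x≢v with V₁-cases V₁x
          ... | inj₁ x≡v = contradiction x≡v x≢v
          ... | inj₂ Sx  = x≢r , cong₂ _∧_ (parent-adjacent x≢r) (cong₂ _∧_ V₁x V₁p) , V₁p
            where
            x≢r = proj₁ (S-up x Sx)
            V₁p = V₁-intro (proj₂ (S-up x Sx))

        to-r : ∀ x → V₂ x ≡ true → Walk E₂ x r
        to-r = walk-up E₂ (λ x → V₂ x ≡ true) r climb
          where
          climb : ∀ x → V₂ x ≡ true → x ≢ r → x ≢ r × E₂ x (parent x) ≡ true × V₂ (parent x) ≡ true
          climb x V₂x x≢r = x≢r , cong₂ _∧_ (parent-adjacent x≢r) (cong not not-Both) , V₂-intro ¬Sp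
            where
            ¬Sp : ¬ S (parent x) ≡ true
            ¬Sp Sp = not-both (S-down x x≢r Sp) V₂x
            not-Both : Both x (parent x) ≡ false
            not-Both with x ≟ v
            ... | yes refl = V₁-outside p≢v (Bool.¬-not ¬Sp)
              where p≢v = λ p≡v → ~-irrefl (parent-adjacent x≢r) (sym p≡v)
            ... | no _ = cong (_∧ V₁ (parent x)) (Bool.not-injective V₂x)

        S-root : S r ≡ false
        S-root = Bool.¬-not λ Sr → proj₁ (S-up r Sr) refl

        V₁v : V₁ v ≡ true
        V₁v = V₁-intro (inj₁ refl)

        tree₁ : IsTree V₁ E₁
        tree₁ = (v , V₁v)
              , connected-via v (proj₁ (proj₂ E₁-subgraph)) to-v
              , acyclic-⊆ (proj₁ E₁-subgraph) acyclic

        tree₂ : IsTree V₂ E₂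
        tree₂ = (r , cong not S-root)
              , connected-via r (proj₁ (proj₂ E₂-subgraph)) to-r
              , acyclic-⊆ (proj₁ E₂-subgraph) acyclic

        decomposition : SubtreeDecomposition T V₁ E₁ V₂ E₂
        decomposition = (E₁-subgraph , tree₁) , (E₂-subgraph , tree₂) , (partition , disjoint)
                      , (v , V₁v , cong not v∉S , only-v)
          where
          partition : ∀ x y → adj x y ≡ true → E₁ x y ≡ true ⊎ E₂ x y ≡ true
          partition x y x~y with Both x y
          ... | true  = inj₁ (cong (_∧ true) x~y)
          ... | false = inj₂ (cong (_∧ true) x~y)
          disjoint : ∀ x y → ¬ (E₁ x y ≡ true × E₂ x y ≡ true)
          disjoint x y (e₁ , e₂) = not-both (Bool.∧-conicalʳ (adj x y) _ e₁) (Bool.∧-conicalʳ (adj x y) _ e₂)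
          only-v : ∀ w → V₁ w ≡ true → V₂ w ≡ true → w ≡ v
          only-v w V₁w V₂w with V₁-cases V₁w
          ... | inj₁ w≡v = w≡v
          ... | inj₂ Sw  = ⊥-elim (not-both Sw V₂w)

module BalancedSplit where

  open import Data.Bool using (Bool; true; false)
  open import Data.Fin using (Fin; toℕ; _≟_)
  open import Data.Fin.Properties using (any?; toℕ-injective; toℕ<n)
  open import Data.Integer as ℤ using (ℤ; 0ℤ)
  import Data.Integer.Properties as ℤ
  open import Data.Nat using (ℕ; suc; _≤_; _<_; _≤?_; _<?_; z≤n)
  open import Data.Nat.Properties hiding (_≟_)
  import Data.Nat as ℕ
  open import Data.Product using (∃; _×_; _,_; proj₁; proj₂)
  open import Data.Sum using (_⊎_; inj₁; inj₂)
  open import Function using (_∘_; _⇔_; mk⇔)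
  open import Relation.Binary.PropositionalEquality
  open import Relation.Nullary using (¬_; yes; no; does)
  open import Relation.Nullary.Decidable using (_×-dec_; dec-true; dec-false)
  open import Relation.Unary using (Decidable)
  open import Relation.Unary.Properties using (_∪?_)
  open Extremal using (maximiser; discrete-ivt)
  open Weights using (weight; weight-cong; weight-⇔; weight-⊎; weight-∅; weight-single; does-true⁻)
  open RootedTrees using (SubtreeDecomposition; module Rooted)

  module Split {n} (T : Graph n) (tree : IsTreeGraph T) (w : Fin n → ℤ) (θ : ℤ)
               (θ>0 : 0ℤ ℤ.< θ) (w<θ : ∀ x → w x ℤ.< θ) (θ≤total : θ ℤ.≤ weight w (λ _ → true)) where

    r : Fin n
    r = proj₁ (proj₁ tree)

    open Rooted T r (λ x → proj₁ (proj₂ tree) x r refl refl)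

    Below : Fin n → Fin n → Set
    Below u x = depth u ≤ depth x × ancestorAt (depth u) x ≡ u

    below? : ∀ u → Decidable (Below u)
    below? u x = (depth u ≤? depth x) ×-dec (ancestorAt (depth u) x ≟ u)

    Heavy : Fin n → Set
    Heavy u = θ ℤ.≤ weight w (does ∘ below? u)

    root-heavy : Heavy r
    root-heavy = subst (θ ℤ.≤_) (weight-cong w λ x → sym (dec-true (below? r x) (below-root x))) θ≤total
      where
      below-root : ∀ x → Below r x
      below-root x = subst (_≤ depth x) (sym depth-root) z≤n
                   , trans (cong (λ k → ancestorAt k x) depth-root) (ancestorAt-zero x)

    deepest-heavy : ∃ λ v → Heavy v × (∀ u → Heavy u → depth u ≤ depth v)
    deepest-heavy = maximiser Heavy (λ u → θ ℤ.≤? weight w (does ∘ below? u)) depth r root-heavy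

    v : Fin n
    v = proj₁ deepest-heavy

    v-heavy : Heavy v
    v-heavy = proj₁ (proj₂ deepest-heavy)

    v-deepest : ∀ u → Heavy u → depth u ≤ depth v
    v-deepest = proj₂ (proj₂ deepest-heavy)

    branch : Fin n → ℕ
    branch x = toℕ (ancestorAt (suc (depth v)) x)

    InBranches InBranch : ℕ → Fin n → Set
    InBranches k x = depth v < depth x × ancestorAt (depth v) x ≡ v × branch x < k
    InBranch   k x = depth v < depth x × ancestorAt (depth v) x ≡ v × branch x ≡ k

    inBranches? : ∀ k → Decidable (InBranches k)
    inBranches? k x = (depth v <? depth x) ×-dec (ancestorAt (depth v) x ≟ v) ×-dec (branch x <? k)
    inBranch? : ∀ k → Decidable (InBranch k)
    inBranch? k x = (depth v <? depth x) ×-dec (ancestorAt (depth v) x ≟ v) ×-dec (branch x ℕ.≟ k)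

    Part : ℕ → Fin n → Set
    Part k x = x ≡ v ⊎ InBranches k x

    part? : ∀ k → Decidable (Part k)
    part? k = (_≟ v) ∪? inBranches? k

    partWeight : ℕ → ℤ
    partWeight k = weight w (does ∘ part? k)

    part-suc : ∀ k → partWeight (suc k) ≡ partWeight k ℤ.+ weight w (does ∘ inBranch? k)
    part-suc k = trans (weight-⇔ w (part? (suc k)) (part? k ∪? inBranch? k) (λ x → mk⇔ to from))
                       (weight-⊎ w (part? k) (inBranch? k) disjoint)
      where
      to : ∀ {x} → Part (suc k) x → Part k x ⊎ InBranch k x
      to (inj₁ x≡v) = inj₁ (inj₁ x≡v)
      to (inj₂ (v<x , anc , b<1+k)) with m≤n⇒m<n∨m≡n (≤-pred b<1+k)
      ... | inj₁ b<k = inj₁ (inj₂ (v<x , anc , b<k))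
      ... | inj₂ b≡k = inj₂ (v<x , anc , b≡k)
      from : ∀ {x} → Part k x ⊎ InBranch k x → Part (suc k) x
      from (inj₁ (inj₁ x≡v))               = inj₁ x≡v
      from (inj₁ (inj₂ (v<x , anc , b<k))) = inj₂ (v<x , anc , m<n⇒m<1+n b<k)
      from (inj₂ (v<x , anc , b≡k))        = inj₂ (v<x , anc , ≤-reflexive (cong suc b≡k))
      disjoint : ∀ x → ¬ (Part k x × InBranch k x)
      disjoint x (inj₁ refl , v<v , _)               = <-irrefl refl v<v
      disjoint x (inj₂ (_ , _ , b<k) , _ , _ , b≡k)  = <-irrefl b≡k b<k

    branch-light : ∀ k → weight w (does ∘ inBranch? k) ℤ.< θ
    branch-light k with any? (inBranch? k)
    ... | no none = subst (ℤ._< θ) (sym (weight-∅ w (inBranch? k) λ x p → none (x , p))) θ>0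
    ... | yes (x₀ , v<x₀ , anc₀ , b₀) = ℤ.≰⇒> λ heavy →
          1+n≰n (subst (_≤ depth v) depth-child (v-deepest child (subst (θ ℤ.≤_) branch≡subtree heavy)))
      where
      child : Fin n
      child = ancestorAt (suc (depth v)) x₀
      depth-child : depth child ≡ suc (depth v)
      depth-child = depth-ancestorAt v<x₀
      parent-child : parent child ≡ v
      parent-child = trans (parent-ancestorAt v<x₀) anc₀
      to : ∀ {x} → InBranch k x → Below child x
      to {x} (v<x , _ , b≡k) = subst (_≤ depth x) (sym depth-child) v<x
                             , trans (cong (λ j → ancestorAt j x) depth-child) (toℕ-injective (trans b≡k (sym b₀)))
      from : ∀ {x} → Below child x → InBranch k x
      from {x} (c≤x , anc) = v<x , trans (sym (parent-ancestorAt v<x)) (trans (cong parent anc′) parent-child)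
                                 , trans (cong toℕ anc′) b₀
        where
        v<x = subst (_≤ depth x) depth-child c≤x
        anc′ = trans (cong (λ j → ancestorAt j x) (sym depth-child)) anc
      branch≡subtree : weight w (does ∘ inBranch? k) ≡ weight w (does ∘ below? child)
      branch≡subtree = weight-⇔ w (inBranch? k) (below? child) (λ x → mk⇔ to from)

    part-zero-light : partWeight 0 ℤ.< θ
    part-zero-light = subst (ℤ._< θ) (sym (weight-single w (part? 0) v (inj₁ refl) only-v)) (w<θ v)
      where
      only-v : ∀ x → Part 0 x → x ≡ v
      only-v x (inj₁ x≡v) = x≡v

    part-all-heavy : θ ℤ.≤ partWeight n
    part-all-heavy = subst (θ ℤ.≤_) (weight-⇔ w (below? v) (part? n) (λ x → mk⇔ from to)) v-heavy
      where
      to : ∀ {x} → Part n x → Below v x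
      to (inj₁ refl)             = ≤-refl , ancestorAt-depth v
      to (inj₂ (v<x , anc , _)) = <⇒≤ v<x , anc
      from : ∀ {x} → Below v x → Part n x
      from {x} (v≤x , anc) with m≤n⇒m<n∨m≡n v≤x
      ... | inj₁ v<x = inj₂ (v<x , anc , toℕ<n _)
      ... | inj₂ v≡x = inj₁ (trans (sym (ancestorAt-depth x)) (trans (cong (λ j → ancestorAt j x) (sym v≡x)) anc))

    cut-index : ∃ λ k → θ ℤ.≤ partWeight k × partWeight k ℤ.< θ ℤ.+ θ
    cut-index = discrete-ivt partWeight θ θ jump part-zero-light n part-all-heavy
      where
      jump : ∀ k → partWeight (suc k) ℤ.< partWeight k ℤ.+ θ
      jump k = subst (ℤ._< partWeight k ℤ.+ θ) (sym (part-suc k)) (ℤ.+-monoʳ-< (partWeight k) (branch-light k))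

    module Cutting (k : ℕ) where

      InBranches-up : ∀ {x} → InBranches k x → x ≢ r × (parent x ≡ v ⊎ InBranches k (parent x))
      InBranches-up {x} (v<x , anc , b<k) = x≢r , result
        where
        x≢r = depth>0⇒≢root (≤-<-trans z≤n v<x)
        v≤p : depth v ≤ depth (parent x)
        v≤p = ≤-pred (subst (depth v <_) (depth-parent x≢r) v<x)
        anc′ : ancestorAt (depth v) (parent x) ≡ v
        anc′ = trans (ancestorAt-parent x≢r v≤p) anc
        result : parent x ≡ v ⊎ InBranches k (parent x)
        result with m≤n⇒m<n∨m≡n v≤p
        ... | inj₁ v<p = inj₂ (v<p , anc′ , subst (_< k) (cong toℕ (sym (ancestorAt-parent x≢r v<p))) b<k)
        ... | inj₂ v≡p = inj₁ (trans (sym (ancestorAt-depth (parent x)))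
                                     (trans (cong (λ j → ancestorAt j (parent x)) (sym v≡p)) anc′))

      InBranches-down : ∀ {x} → x ≢ r → InBranches k (parent x) → InBranches k x
      InBranches-down {x} x≢r (v<p , anc , b<k) =
          subst (depth v <_) (sym (depth-parent x≢r)) (m<n⇒m<1+n v<p)
        , trans (sym (ancestorAt-parent x≢r (<⇒≤ v<p))) anc
        , subst (_< k) (cong toℕ (ancestorAt-parent x≢r v<p)) b<k

      S : Fin n → Bool
      S = does ∘ inBranches? k

      S-up : ∀ x → S x ≡ true → x ≢ r × (parent x ≡ v ⊎ S (parent x) ≡ true)
      S-up x Sx with InBranches-up (does-true⁻ (inBranches? k x) Sx)
      ... | x≢r , inj₁ p≡v = x≢r , inj₁ p≡v
      ... | x≢r , inj₂ p∈S = x≢r , inj₂ (dec-true (inBranches? k (parent x)) p∈S)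

      S-down : ∀ x → x ≢ r → S (parent x) ≡ true → S x ≡ true
      S-down x x≢r Sp = dec-true (inBranches? k x) (InBranches-down x≢r (does-true⁻ (inBranches? k (parent x)) Sp))

      v∉S : S v ≡ false
      v∉S = dec-false (inBranches? k v) λ (v<v , _) → <-irrefl refl v<v

      open Cut (proj₂ (proj₂ tree)) v S S-up S-down v∉S public

    balanced : ∃ λ V₁ → ∃ λ E₁ → ∃ λ V₂ → ∃ λ E₂ →
               SubtreeDecomposition T V₁ E₁ V₂ E₂ × θ ℤ.≤ weight w V₁ × weight w V₁ ℤ.< θ ℤ.+ θ
    balanced = let k , lower , upper = cut-index
                   open Cutting k
               in V₁ , E₁ , V₂ , E₂ , decomposition , lower , upper

  balanced-split : ∀ {n} (T : Graph n) → IsTreeGraph T → (w : Fin n → ℤ) (θ : ℤ) →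
    0ℤ ℤ.< θ → (∀ x → w x ℤ.< θ) → θ ℤ.≤ weight w (λ _ → true) →
    ∃ λ V₁ → ∃ λ E₁ → ∃ λ V₂ → ∃ λ E₂ →
      SubtreeDecomposition T V₁ E₁ V₂ E₂ × θ ℤ.≤ weight w V₁ × weight w V₁ ℤ.< θ ℤ.+ θ
  balanced-split = Split.balanced


module ColourSplit where

  open import Data.Bool using (Bool; true; false)
  open import Data.Fin using (Fin)
  open import Data.Integer as ℤ using (ℤ; +_)
  import Data.Integer.Properties as ℤ
  open import Data.Nat using (ℕ; zero; suc; _<_; z≤n)
  open import Data.Product using (∃; _×_; _,_)
  open import Function using (_∘_)
  open import Relation.Binary.PropositionalEquality
  open Weights using (weight-scale; sign; imbalance)
  open RootedTrees using (SubtreeDecomposition)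
  open BalancedSplit using (balanced-split)

  scaled-sign-≤ : ∀ b s → + b ℤ.* sign s ℤ.≤ + b
  scaled-sign-≤ b       true  = ℤ.≤-reflexive (ℤ.*-identityʳ (+ b))
  scaled-sign-≤ zero    false = ℤ.≤-refl
  scaled-sign-≤ (suc b) false = ℤ.-≤+

  imbalanced-split : ∀ {n} (T : Graph n) → IsTreeGraph T → (c : Fin n → Bool) (a b : ℕ) → b < a →
    + a ℤ.≤ + b ℤ.* imbalance c (λ _ → true) →
    ∃ λ V₁ → ∃ λ E₁ → ∃ λ V₂ → ∃ λ E₂ → SubtreeDecomposition T V₁ E₁ V₂ E₂ ×
      + a ℤ.≤ + b ℤ.* imbalance c V₁ × + b ℤ.* imbalance c V₁ ℤ.< + a ℤ.+ + a
  imbalanced-split T tree c a b b<a total =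
    let V₁ , E₁ , V₂ , E₂ , decomposition , lower , upper =
          balanced-split T tree (λ x → + b ℤ.* sign (c x)) (+ a) (ℤ.≤-<-trans (ℤ.+≤+ z≤n) (ℤ.+<+ b<a))
            (λ x → ℤ.≤-<-trans (scaled-sign-≤ b (c x)) (ℤ.+<+ b<a))
            (subst (+ a ℤ.≤_) (sym (weight-scale (+ b) (sign ∘ c) (λ _ → true))) total)
    in V₁ , E₁ , V₂ , E₂ , decomposition ,
       subst (+ a ℤ.≤_) (weight-scale (+ b) (sign ∘ c) V₁) lower ,
       subst (ℤ._< + a ℤ.+ + a) (weight-scale (+ b) (sign ∘ c) V₁) upper

module MajoritySplit where

  open import Data.Bool using (Bool; true; not)
  open import Data.Fin using (Fin)
  open import Data.Integer as ℤ using (ℤ; +_)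
  import Data.Integer.Properties as ℤ
  open import Data.Nat using (ℕ; _+_; _*_; _∸_; _≤_; _<_; z≤n; s≤s; >-nonZero)
  open import Data.Nat.Properties
  open import Data.Nat.Tactic.RingSolver using (solve-∀)
  open import Data.Product using (∃; _×_; _,_; proj₁; proj₂)
  open import Relation.Binary.PropositionalEquality
  open Weights using (count-complement; surplus; surplus≡imbalance; imbalance)
  open RootedTrees using (SubtreeDecomposition)
  open ColourSplit using (imbalanced-split)

  majority-margin : ∀ A B → 11 * B ≤ 10 * A → B ≤ A × A + B ≤ 21 * (A ∸ B)
  majority-margin A B majority = B≤A , subst (λ m → m + B ≤ 21 * D) A≡B+D (≤-trans regrouped 2B+D≤21D)
    where
    D : ℕ
    D = A ∸ B
    B≤A : B ≤ A
    B≤A = *-cancelˡ-≤ 10 (≤-trans (*-monoˡ-≤ B (n≤1+n 10)) majority)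
    A≡B+D : B + D ≡ A
    A≡B+D = m+[n∸m]≡n B≤A
    split-11 : ∀ B → 11 * B ≡ 10 * B + B
    split-11 = solve-∀
    split-10 : ∀ B D → 10 * (B + D) ≡ 10 * B + 10 * D
    split-10 = solve-∀
    B≤10D : B ≤ 10 * D
    B≤10D = +-cancelˡ-≤ (10 * B) B (10 * D)
              (subst₂ _≤_ (split-11 B) (trans (cong (10 *_) (sym A≡B+D)) (split-10 B D)) majority)
    regroup : ∀ B D → (B + D) + B ≡ B + B + D
    regroup = solve-∀
    sum-21 : ∀ D → 10 * D + 10 * D + D ≡ 21 * D
    sum-21 = solve-∀
    regrouped : (B + D) + B ≤ B + B + D
    regrouped = ≤-reflexive (regroup B D)
    2B+D≤21D : B + B + D ≤ 21 * D
    2B+D≤21D = subst (B + B + D ≤_) (sum-21 D) (+-mono-≤ (+-mono-≤ B≤10D B≤10D) (≤-refl {D}))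

  pos-*³ : ∀ k p n → + (k * p * n) ≡ + k ℤ.* + p ℤ.* + n
  pos-*³ k p n = trans (ℤ.pos-* (k * p) n) (cong (ℤ._* + n) (ℤ.pos-* k p))

  majority-split : ∀ {n} (T : Graph n) → IsTreeGraph T → (c : Fin n → Bool) → ∀ p q →
    0 < p → 210 * p ≤ q → q ≤ n → 11 * count (λ x → not (c x)) ≤ 10 * count c →
    ∃ λ V₁ → ∃ λ E₁ → ∃ λ V₂ → ∃ λ E₂ → SubtreeDecomposition T V₁ E₁ V₂ E₂ ×
      + 10 ℤ.* + p ℤ.* + n ℤ.≤ surplus c V₁ ℤ.* + q × surplus c V₁ ℤ.* + q ℤ.≤ + 25 ℤ.* + p ℤ.* + n
  majority-split {n} T tree c p q 0<p 210p≤q q≤n majority =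
    let V₁ , E₁ , V₂ , E₂ , decomposition , lower , upper = imbalanced-split T tree c a q q<a threshold
    in V₁ , E₁ , V₂ , E₂ , decomposition ,
       subst₂ ℤ._≤_ (pos-*³ 10 p n) (to-surplus V₁) lower ,
       subst₂ ℤ._≤_ (to-surplus V₁) (pos-*³ 25 p n) (ℤ.≤-trans (ℤ.<⇒≤ upper) 2a≤25pn)
    where
    a A B D : ℕ
    a = 10 * p * n
    A = count c
    B = count (λ x → not (c x))
    D = A ∸ B
    B≤A : B ≤ A
    B≤A = proj₁ (majority-margin A B majority)
    n≤21D : n ≤ 21 * D
    n≤21D = subst (_≤ 21 * D) (count-complement c) (proj₂ (majority-margin A B majority))
    a≤qD : a ≤ q * D
    a≤qD = ≤-trans (*-monoʳ-≤ (10 * p) n≤21D) (≤-trans (≤-reflexive (regroup p D)) (*-monoˡ-≤ D 210p≤q))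
      where
      regroup : ∀ p D → 10 * p * (21 * D) ≡ 210 * p * D
      regroup = solve-∀
    to-surplus : ∀ V → + q ℤ.* imbalance c V ≡ surplus c V ℤ.* + q
    to-surplus V = trans (ℤ.*-comm (+ q) _) (cong (ℤ._* + q) (sym (surplus≡imbalance c V)))
    threshold : + a ℤ.≤ + q ℤ.* imbalance c (λ _ → true)
    threshold = subst (+ a ℤ.≤_) (trans (ℤ.pos-* q D) to-surplus-total) (ℤ.+≤+ a≤qD)
      where
      to-surplus-total : + q ℤ.* + D ≡ + q ℤ.* imbalance c (λ _ → true)
      to-surplus-total = cong (+ q ℤ.*_)
        (trans (sym (trans (ℤ.[+m]-[+n]≡m⊖n A B) (ℤ.⊖-≥ B≤A))) (surplus≡imbalance c _))
    q<a : q < a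
    q<a = ≤-<-trans q≤n (subst (n <_) (*-comm n (10 * p)) (m<m*n n (10 * p) {{>-nonZero 0<n}} 1<10p))
      where
      10≤10p : 10 ≤ 10 * p
      10≤10p = *-monoʳ-≤ 10 0<p
      0<n : 0 < n
      0<n = ≤-trans 0<p (≤-trans (m≤n*m p 210) (≤-trans 210p≤q q≤n))
      1<10p : 1 < 10 * p
      1<10p = ≤-trans (s≤s (s≤s z≤n)) 10≤10p
    2a≤25pn : + a ℤ.+ + a ℤ.≤ + (25 * p * n)
    2a≤25pn = subst (ℤ._≤ + (25 * p * n)) (ℤ.pos-+ a a)
                (ℤ.+≤+ (subst₂ _≤_ (sym (double p n)) (sym (twenty-five p n)) (*-monoˡ-≤ (p * n) (m≤m+n 20 5))))
      where
      double : ∀ p n → 10 * p * n + 10 * p * n ≡ 20 * (p * n)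
      double = solve-∀
      twenty-five : ∀ p n → 25 * p * n ≡ 25 * (p * n)
      twenty-five = solve-∀

module RationalBounds where

  open import Data.Integer as ℤ using (ℤ; +_)
  open import Data.Nat as ℕ using (ℕ; suc)
  import Data.Nat.Properties as ℕ
  open import Data.Rational using (mkℚ; _/_; _≤_; toℚᵘ; ↥_; ↧_; _*_)
  open import Data.Rational.Properties using (toℚᵘ-cancel-≤; toℚᵘ-homo-*; toℚᵘ-fromℚᵘ)
  import Data.Rational.Unnormalised as ℚᵘ
  import Data.Rational.Unnormalised.Properties as ℚᵘ
  open import Data.Integer.Tactic.RingSolver using (solve-∀)
  open import Relation.Binary.PropositionalEquality

  toℚᵘ-/1 : ∀ z → toℚᵘ (z / 1) ℚᵘ.≃ ℚᵘ.mkℚᵘ z 0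
  toℚᵘ-/1 z = toℚᵘ-fromℚᵘ (ℚᵘ.mkℚᵘ z 0)

  toℚᵘ-scaled : ∀ k μ n → toℚᵘ ((k / 1) * μ * (+ n / 1)) ℚᵘ.≃ ℚᵘ.mkℚᵘ k 0 ℚᵘ.* toℚᵘ μ ℚᵘ.* ℚᵘ.mkℚᵘ (+ n) 0
  toℚᵘ-scaled k μ n = ℚᵘ.≃-trans (toℚᵘ-homo-* ((k / 1) * μ) (+ n / 1))
    (ℚᵘ.*-cong (ℚᵘ.≃-trans (toℚᵘ-homo-* (k / 1) μ) (ℚᵘ.*-cong (toℚᵘ-/1 k) ℚᵘ.≃-refl)) (toℚᵘ-/1 (+ n)))

  ×1 : ∀ (x : ℤ) → x ≡ x ℤ.* + 1
  ×1 = solve-∀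

  denominator-/1 : ∀ d → + (1 ℕ.* suc d ℕ.* 1) ≡ + suc d
  denominator-/1 d = cong +_ (trans (ℕ.*-identityʳ (1 ℕ.* suc d)) (ℕ.*-identityˡ (suc d)))

  scaled-≤-/1 : ∀ k μ n z → k ℤ.* ↥ μ ℤ.* + n ℤ.≤ z ℤ.* ↧ μ → (k / 1) * μ * (+ n / 1) ≤ z / 1
  scaled-≤-/1 k μ@(mkℚ p d _) n z cross = toℚᵘ-cancel-≤
    (ℚᵘ.≤-respˡ-≃ (ℚᵘ.≃-sym (toℚᵘ-scaled k μ n)) (ℚᵘ.≤-respʳ-≃ (ℚᵘ.≃-sym (toℚᵘ-/1 z))
      (ℚᵘ.*≤* (subst₂ ℤ._≤_ (×1 (k ℤ.* p ℤ.* + n)) (cong (z ℤ.*_) (sym (denominator-/1 d))) cross))))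

  /1-≤-scaled : ∀ k μ n z → z ℤ.* ↧ μ ℤ.≤ k ℤ.* ↥ μ ℤ.* + n → z / 1 ≤ (k / 1) * μ * (+ n / 1)
  /1-≤-scaled k μ@(mkℚ p d _) n z cross = toℚᵘ-cancel-≤
    (ℚᵘ.≤-respʳ-≃ (ℚᵘ.≃-sym (toℚᵘ-scaled k μ n)) (ℚᵘ.≤-respˡ-≃ (ℚᵘ.≃-sym (toℚᵘ-/1 z))
      (ℚᵘ.*≤* (subst₂ ℤ._≤_ (cong (z ℤ.*_) (sym (denominator-/1 d))) (×1 (k ℤ.* p ℤ.* + n)) cross))))

open import Data.Nat using (ℕ; _≥_; _*_)
open import Data.Bool using (Bool; true; not; _∧_)
open import Data.Fin using (Fin)
open import Data.Integer using (+_; _-_)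
open import Data.Rational using (ℚ; _/_; _<_; _≤_; 0ℚ) renaming (_*_ to _*ℚ_)
open import Data.Product using (Σ; ∃; _×_; _,_)
open import Relation.Binary.PropositionalEquality using (_≡_)

open import Data.Integer using (-[1+_]; +<+; +≤+)
import Data.Nat as ℕ
open import Data.Nat.Properties using (*-comm; *-identityˡ)
open import Data.Rational using (mkℚ; *<*; *≤*)
open import Relation.Binary.PropositionalEquality using (subst₂)
open RationalBounds using (scaled-≤-/1; /1-≤-scaled)
open MajoritySplit using (majority-split)
open Weights using (surplus)

proposition7p4 :
  Σ ℚ λ μ₀ → (0ℚ < μ₀) ×
  (∀ (μ : ℚ) → 0ℚ < μ → μ ≤ μ₀ →
    Σ ℕ λ n₀ → ∀ (n : ℕ) → n ≥ n₀ →
      ∀ (T : Graph n) → IsTreeGraph T →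
      ∀ (c : Fin n → Bool) → IsBipartition T c →
      10 * count c ≥ 11 * count (λ x → not (c x)) →
      ∃ λ V₁' → ∃ λ E₁ → ∃ λ V₂' → ∃ λ E₂ →
        IsSubtree T V₁' E₁ × IsSubtree T V₂' E₂ × EdgePartition T E₁ E₂ ×
        (∃ λ v → V₁' v ≡ true × V₂' v ≡ true ×
           (∀ w → V₁' w ≡ true → V₂' w ≡ true → w ≡ v)) ×
        (((+ 10) / 1) *ℚ μ *ℚ ((+ n) / 1)
           ≤ ((+ count (λ x → V₁' x ∧ c x) - + count (λ x → V₁' x ∧ not (c x))) / 1)) ×
        (((+ count (λ x → V₁' x ∧ c x) - + count (λ x → V₁' x ∧ not (c x))) / 1)
           ≤ ((+ 25) / 1) *ℚ μ *ℚ ((+ n) / 1)))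
proposition7p4 = + 1 / 210 , *<* (+<+ (ℕ.s≤s ℕ.z≤n)) , λ where
  (mkℚ (+ ℕ.zero) _ _) (*<* (+<+ ())) _
  (mkℚ -[1+ _ ] _ _)   (*<* ()) _
  -- The colouring need not be proper.
  μ@(mkℚ (+ ℕ.suc p) q-1 _) _ (*≤* (+≤+ p·210≤q)) → ℕ.suc q-1 , λ n q≤n T tree c _ majority →
    let V₁ , E₁ , V₂ , E₂ , (sub₁ , sub₂ , partition , meet) , lower , upper =
          majority-split T tree c (ℕ.suc p) (ℕ.suc q-1) (ℕ.s≤s ℕ.z≤n)
            (subst₂ ℕ._≤_ (*-comm (ℕ.suc p) 210) (*-identityˡ (ℕ.suc q-1)) p·210≤q) q≤n majority
    in V₁ , E₁ , V₂ , E₂ , sub₁ , sub₂ , partition , meet ,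
       scaled-≤-/1 (+ 10) μ n (surplus c V₁) lower , /1-≤-scaled (+ 25) μ n (surplus c V₁) upper
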